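{- Let $\mathcal{A}=(\Sigma,Q,I,\delta,\gamma)$ be a universal co-Büchi automaton and let $\mathcal{C}$ be the NBA obtained from $\mathcal{A}$ by the rank-based construction. Then $\mathcal{L}(\mathcal{C})\subseteq\mathcal{L}(\mathcal{A})$.
   Context: $\mathcal{A}$ has finite alphabet $\Sigma$, finite state set $Q$ with $n=|Q|$, set of initial states $I\subseteq Q$, transitions $\delta:Q\times\Sigma\to2^Q$, and distinguished transitions $\gamma:Q\times\Sigma\to 2^Q$ with $\gamma(q,\sigma)\subseteq\delta(q,\sigma)$. Read as a UCA, $\mathcal{L}(\mathcal{A})$ is the set of words with no run from $I$ that uses transitions of $\gamma$ infinitely often. For $S\subseteq Q$ write $\delta(S,\sigma)=\bigcup_{q\in S}\delta(q,\sigma)$, $\gamma(S,\sigma)=\bigcup_{q\in S}\gamma(q,\sigma)$. For finite $S\subseteq Q$, a function $f:S\to\mathbb{N}$ is $S$-tight if for some $m\le|S|$ it maps $S$ into $\{0,1,\ldots,2m-1\}$ and onto $\{1,3,\ldots,2m-1\}$; $\mathcal{T}_S$ is the set of $S$-tight functions and $\mathsf{rank}(f)=\max_{q\in S}f(q)$. The rank-based construction is the NBA $\mathcal{C}=(\Sigma,Q',\{I\},\delta',\gamma')$ with: $Q'=Q_1\cup Q_2$, $Q_1=2^Q$, $Q_2=\{(S,O,f,i)\in 2^Q\times2^Q\times\mathcal{T}_S\times\{0,2,\ldots,2n-2\}\mid O\subseteq f^{ -1}(i)\}$; initial state $I\in Q_1$; $\delta'=\delta_1\cup\delta_2\cup\delta_3$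 where $\delta_1(S,\sigma)=\{\delta(S,\sigma)\}$; $(S',O,f,i)\in\delta_2(S,\sigma)$ iff $S'=\delta(S,\sigma)$, $O=\emptyset$, $i=0$ (with $f\in\mathcal{T}_{S'}$ arbitrary); and $(S',O',f',i')\in\delta_3((S,O,f,i),\sigma)$ iff $S'=\delta(S,\sigma)$ and, with $g(q)=\{j\mid q\in\delta(f^{ -1}(j),\sigma)\}\cup\{2\lfloor j/2\rfloor\mid q\in\gamma(f^{ -1}(j),\sigma)\}$ for $q\in S'$, $f'(q)=\min g(q)$ is $S'$-tight (otherwise there is no transition), and: letting $O''=\delta(O,\sigma)\cap f'^{ -1}(i)$, if $O''\ne\emptyset$ then $O'=O''$ and $i'=i$ (case (2)); else $i'=(i+2)\bmod(\mathsf{rank}(f')+1)$ and $O'=f'^{ -1}(i')$ (case (3)). The accepting transitions $\gamma'$ of $\mathcal{C}$ are the $\delta_3$-transitions of case (3) together with the transitions from the state $\emptyset\in Q_1$. $\mathcal{L}(\mathcal{C})$ is the set of words with a run from $I$ using accepting transitions infinitely often. -}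

module Defs where

open import Data.Nat using (ℕ; zero; suc; _+_; _*_; _≤_; _<_; _⊔_; _/_; _%_)
open import Data.Fin using (Fin)
open import Data.Fin.Subset using (Subset; _∈_; _∉_; ∣_∣) renaming (⊥ to ∅)
open import Data.Vec using (lookup)
open import Data.List using (foldr; allFin)
open import Data.Bool using (if_then_else_)
open import Data.Product using (Σ; ∃; _×_; _,_)
open import Data.Sum using (_⊎_)
open import Relation.Nullary using (¬_)
open import Relation.Binary.PropositionalEquality using (_≡_)
open import Function.Bundles using (_⇔_)

record Automaton (k n : ℕ) : Set where
  field
    I : Subset n
    δ : Fin n → Fin k → Subset n
    γ : Fin n → Fin k → Subset n
    γ⊆δ : ∀ q σ {p} → p ∈ γ q σ → p ∈ δ q σ

Word : ℕ → Set
Word k = ℕ → Fin k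

module _ {k n : ℕ} (A : Automaton k n) where
  open Automaton A

  IsRunA : Word k → (ℕ → Fin n) → Set
  IsRunA w r = (r 0 ∈ I) × (∀ j → r (suc j) ∈ δ (r j) (w j))

  InfGamma : Word k → (ℕ → Fin n) → Set
  InfGamma w r = ∀ i → ∃ λ j → (i ≤ j) × (r (suc j) ∈ γ (r j) (w j))

  InLangUCA : Word k → Set
  InLangUCA w = ∀ r → IsRunA w r → ¬ InfGamma w r

  IsPost : Subset n → Fin k → Subset n → Set
  IsPost S σ S' = ∀ q → (q ∈ S') ⇔ (∃ λ p → p ∈ S × q ∈ δ p σ)

  -- Functions f : S → ℕ are represented as Fin n → ℕ with the
  -- normalisation convention f q = 0 for q ∉ S.
  Tight : Subset n → (Fin n → ℕ) → Set
  Tight S f =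
    (∀ q → q ∉ S → f q ≡ 0) ×
    (∃ λ m → (m ≤ ∣ S ∣) ×
             (∀ q → q ∈ S → f q < 2 * m) ×
             (∀ j → j < m → ∃ λ q → q ∈ S × f q ≡ 2 * j + 1))

  rankOf : Subset n → (Fin n → ℕ) → ℕ
  rankOf S f = foldr (λ q acc → if lookup S q then f q ⊔ acc else acc) 0 (allFin n)

  Even : ℕ → Set
  Even i = ∃ λ t → i ≡ 2 * t

  data State : Set where
    q1 : Subset n → State
    q2 : (S O : Subset n) (f : Fin n → ℕ) (i : ℕ) → State

  -- membership in Q' = Q₁ ∪ Q₂
  ValidState : State → Set
  ValidState (q1 S) = Data.Unit.⊤
    where import Data.Unit
  ValidState (q2 S O f i) =
    Tight S f × Even i × (i < 2 * n) ×
    (∀ q → q ∈ O → q ∈ S × f q ≡ i)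

  -- j ∈ g(q), where g(q) = {j | q ∈ δ(f⁻¹(j),σ)} ∪ {2⌊j/2⌋ | q ∈ γ(f⁻¹(j),σ)}
  InG : Subset n → (Fin n → ℕ) → Fin k → Fin n → ℕ → Set
  InG S f σ q j = ∃ λ p → p ∈ S ×
    ((f p ≡ j × q ∈ δ p σ) ⊎ (q ∈ γ p σ × j ≡ 2 * (f p / 2)))

  IsMinRank : Subset n → (Fin n → ℕ) → Fin k → Subset n → (Fin n → ℕ) → Set
  IsMinRank S f σ S' f' =
    (∀ q → q ∈ S' → InG S f σ q (f' q) × (∀ j → InG S f σ q j → f' q ≤ j)) ×
    (∀ q → q ∉ S' → f' q ≡ 0)

  InO'' : Subset n → Fin k → Subset n → (Fin n → ℕ) → ℕ → Fin n → Set
  InO'' O σ S' f' i q = (∃ λ p → p ∈ O × q ∈ δ p σ) × q ∈ S' × f' q ≡ i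

  Step3Core : Subset n → (Fin n → ℕ) → Fin k → Subset n → (Fin n → ℕ) → Set
  Step3Core S f σ S' f' = IsPost S σ S' × IsMinRank S f σ S' f' × Tight S' f'

  Step3Case2 : State → Fin k → State → Set
  Step3Case2 (q2 S O f i) σ (q2 S' O' f' i') =
    Step3Core S f σ S' f' ×
    (∃ λ q → InO'' O σ S' f' i q) ×
    (∀ q → (q ∈ O') ⇔ InO'' O σ S' f' i q) × (i' ≡ i)
  Step3Case2 _ _ _ = Data.Empty.⊥
    where import Data.Empty

  Step3Case3 : State → Fin k → State → Set
  Step3Case3 (q2 S O f i) σ (q2 S' O' f' i') =
    Step3Core S f σ S' f' ×
    (∀ q → ¬ InO'' O σ S' f' i q) ×
    (i' ≡ (i + 2) % suc (rankOf S' f')) ×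
    (∀ q → (q ∈ O') ⇔ (q ∈ S' × f' q ≡ i'))
  Step3Case3 _ _ _ = Data.Empty.⊥
    where import Data.Empty

  Step12 : State → Fin k → State → Set
  Step12 (q1 S) σ (q1 S') = IsPost S σ S'
  Step12 (q1 S) σ (q2 S' O f i) = IsPost S σ S' × (O ≡ ∅) × (i ≡ 0) × Tight S' f
  Step12 (q2 _ _ _ _) σ _ = Data.Empty.⊥
    where import Data.Empty

  StepC : State → Fin k → State → Set
  StepC s σ s' = ValidState s' × (Step12 s σ s' ⊎ Step3Case2 s σ s' ⊎ Step3Case3 s σ s')

  AccC : State → Fin k → State → Set
  AccC s σ s' = StepC s σ s' × (Step3Case3 s σ s' ⊎ (s ≡ q1 ∅))

  IsRunC : Word k → (ℕ → State) → Set
  IsRunC w ρ = (ρ 0 ≡ q1 I) × (∀ j → StepC (ρ j) (w j) (ρ (suc j)))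

  InLangC : Word k → Set
  InLangC w = ∃ λ ρ → IsRunC w ρ ×
    (∀ i → ∃ λ j → (i ≤ j) × AccC (ρ j) (w j) (ρ (suc j)))

-- Suppose C accepts w along ρ while A has a run r on w through γ infinitely
-- often. Every state of ρ contains r, so ρ is never ∅ and from its first
-- accepting transition on it stays in Q₂. Along δ₃ the rank of r and the
-- maximal rank never increase, so both are eventually constant, say v and
-- 2M+1; as r keeps taking γ-transitions, which round ranks down to even
-- values, v is even. Each case-(3) step moves the index i one step around
-- the cycle 0, 2, …, 2M, so it eventually reaches v, at which point r enters
-- the obligation set O. From then on r witnesses O'' ≠ ∅ at every step,
-- hence case (3) never occurs again, contradicting acceptance.
module Submission where

open import Data.Bool using (true; false; if_then_else_)
open import Data.Empty using (⊥; ⊥-elim)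
open import Data.Fin using (Fin)
open import Data.Fin.Subset using (Subset; _∈_) renaming (⊥ to ∅)
open import Data.Fin.Subset.Properties using (∉⊥)
open import Data.List using (List; []; _∷_; foldr; allFin)
open import Data.List.Membership.Propositional using () renaming (_∈_ to _∈ˡ_)
open import Data.List.Membership.Propositional.Properties using (∈-allFin)
open import Data.List.Relation.Unary.Any using (here; there)
open import Data.Nat
open import Data.Nat.DivMod using (m%n<n; m<n⇒m%n≡m; n%n≡0; m/n*n≤m; m%n*o≡m*o%[n*o])
open import Data.Nat.GeneralisedArithmetic using (fold; iterate; fold-+; iterate-is-fold)
open import Data.Nat.Induction using (<-rec)
open import Data.Nat.Properties
open import Data.Product using (∃; _×_; _,_; proj₁; proj₂)
open import Data.Sum using (_⊎_; inj₁; inj₂)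
open import Data.Vec using (lookup)
open import Data.Vec.Properties using ([]=⇒lookup; lookup⇒[]=)
open import Function.Bundles using (Equivalence)
open import Relation.Nullary using (¬_; yes; no)
open import Relation.Binary.PropositionalEquality
open import Defs

upward-induction : ∀ {P : ℕ → Set} {i} → (∀ {j} → i ≤ j → P j → P (suc j)) →
                   P i → ∀ {j} → i ≤ j → P j
upward-induction {P} {i} step Pi i≤j = go (≤⇒≤′ i≤j)
  where
  go : ∀ {j} → i ≤′ j → P j
  go ≤′-refl = Pi
  go (≤′-step i≤′j) = step (≤′⇒≤ i≤′j) (go i≤′j)

module _ (s : ℕ → ℕ) {t₀ : ℕ} (antitone : ∀ j → t₀ ≤ j → s (suc j) ≤ s j) where

  antitone-≤ : ∀ {i j} → t₀ ≤ i → i ≤ j → s j ≤ s i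
  antitone-≤ t₀≤i =
    upward-induction (λ i≤j sj≤si → ≤-trans (antitone _ (≤-trans t₀≤i i≤j)) sj≤si) ≤-refl

  StableFrom : ℕ → Set
  StableFrom t = ∀ j → t ≤ j → s j ≡ s t

  antitone⇒¬¬stable : ¬ ¬ (∃ λ t → t₀ ≤ t × StableFrom t)
  antitone⇒¬¬stable unstable = <-rec BoundedBy bounded (s t₀) t₀ ≤-refl refl
    where
    BoundedBy : ℕ → Set
    BoundedBy b = ∀ t → t₀ ≤ t → s t ≡ b → ⊥

    bounded : ∀ b → (∀ {b'} → b' < b → BoundedBy b') → BoundedBy b
    bounded _ smaller t t₀≤t refl = unstable (t , t₀≤t , stable)
      where
      stable : StableFrom t
      stable j t≤j with s j ≟ s t
      ... | yes sj≡st = sj≡st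
      ... | no sj≢st = ⊥-elim (smaller (≤∧≢⇒< (antitone-≤ t₀≤t t≤j) sj≢st) j (≤-trans t₀≤t t≤j) refl)

cyc : ℕ → ℕ → ℕ
cyc M x = suc x % suc M

fold-cyc : ∀ M x k → k + x ≤ M → fold x (cyc M) k ≡ k + x
fold-cyc M x zero _ = refl
fold-cyc M x (suc k) k+x<M = begin
  cyc M (fold x (cyc M) k) ≡⟨ cong (cyc M) (fold-cyc M x k (<⇒≤ k+x<M)) ⟩
  suc (k + x) % suc M      ≡⟨ m<n⇒m%n≡m (s≤s k+x<M) ⟩
  suc (k + x)              ∎
  where open ≡-Reasoning

-- From x = cyc M e, M ∸ x steps reach M, one more wraps to 0, and c more reach c.
cyc-reaches : ∀ M e {c} → c ≤ M → ∃ λ d → iterate (cyc M) e (suc d) ≡ c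
cyc-reaches M e {c} c≤M = c + suc (M ∸ x) , (begin
  iterate (cyc M) x (c + suc (M ∸ x))            ≡⟨ iterate-is-fold x (cyc M) (c + suc (M ∸ x)) ⟨
  fold x (cyc M) (c + suc (M ∸ x))               ≡⟨ fold-+ x (cyc M) c ⟩
  fold (fold x (cyc M) (suc (M ∸ x))) (cyc M) c  ≡⟨ cong (λ y → fold y (cyc M) c) wraps ⟩
  fold 0 (cyc M) c                               ≡⟨ fold-cyc M 0 c (subst (_≤ M) (sym (+-identityʳ c)) c≤M) ⟩
  c + 0                                          ≡⟨ +-identityʳ c ⟩
  c                                              ∎)
  where
  open ≡-Reasoning
  x : ℕ
  x = cyc M e
  x≤M : x ≤ M
  x≤M = ≤-pred (m%n<n (suc e) (suc M))
  wraps : fold x (cyc M) (suc (M ∸ x)) ≡ 0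
  wraps = trans (cong (cyc M) (trans (fold-cyc M x (M ∸ x) (≤-reflexive (m∸n+n≡m x≤M))) (m∸n+n≡m x≤M)))
                (n%n≡0 (suc M))

double-cyc : ∀ M e → (2 * e + 2) % suc (suc (2 * M)) ≡ 2 * cyc M e
double-cyc M e = begin
  (2 * e + 2) % suc (suc (2 * M)) ≡⟨ cong (λ y → y % suc (suc (2 * M))) (trans (+-comm (2 * e) 2) (cong (2 +_) (*-comm 2 e))) ⟩
  (suc e * 2) % suc (suc (2 * M)) ≡⟨ cong (λ m → (suc e * 2) % suc (suc m)) (*-comm 2 M) ⟩
  (suc e * 2) % (suc M * 2)       ≡⟨ m%n*o≡m*o%[n*o] (suc e) (suc M) 2 ⟨
  suc e % suc M * 2               ≡⟨ *-comm (cyc M e) 2 ⟩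
  2 * cyc M e                     ∎
  where open ≡-Reasoning

half-≤ : ∀ {c M} → 2 * c ≤ suc (2 * M) → c ≤ M
half-≤ {c} {M} 2c≤2M+1 = ≤-pred (*-cancelˡ-< 2 c (suc M) (subst (2 * c <_) (sym (*-suc 2 M)) (s≤s 2c≤2M+1)))

module _ {k n : ℕ} (A : Automaton k n) where
  open Automaton A

  module _ {S : Subset n} {f : Fin n → ℕ} where

    private
      rankOver : List (Fin n) → ℕ
      rankOver = foldr (λ q acc → if lookup S q then f q ⊔ acc else acc) 0

    ≤-rankOf : ∀ {q} → q ∈ S → f q ≤ rankOf A S f
    ≤-rankOf {q} q∈S = go (allFin n) (∈-allFin q)
      where
      go : ∀ xs → q ∈ˡ xs → f q ≤ rankOver xs
      go (_ ∷ xs) (here refl) rewrite []=⇒lookup q∈S = m≤m⊔n (f q) (rankOver xs)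
      go (p ∷ xs) (there q∈xs) with lookup S p
      ... | true = ≤-trans (go xs q∈xs) (m≤n⊔m (f p) (rankOver xs))
      ... | false = go xs q∈xs

    rankOf-lub : ∀ {b} → (∀ {q} → q ∈ S → f q ≤ b) → rankOf A S f ≤ b
    rankOf-lub {b} bound = go (allFin n)
      where
      go : ∀ xs → rankOver xs ≤ b
      go [] = z≤n
      go (p ∷ xs) with lookup S p in Sp≡true
      ... | true = ⊔-lub (bound (lookup⇒[]= p S Sp≡true)) (go xs)
      ... | false = go xs

    tight⇒rank-odd : ∀ {q} → Tight A S f → q ∈ S → ∃ λ M → rankOf A S f ≡ suc (2 * M)
    tight⇒rank-odd (_ , zero , _ , bound , _) q∈S with () ← bound _ q∈S
    tight⇒rank-odd (_ , suc M , _ , bound , onto) _ with onto M ≤-refl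
    ... | p , p∈S , fp≡2M+1 = M , ≤-antisym
      (rankOf-lub λ {q} q∈S → ≤-pred (subst (f q <_) (*-suc 2 M) (bound _ q∈S)))
      (subst (_≤ rankOf A S f) (trans fp≡2M+1 (+-comm (2 * M) 1)) (≤-rankOf p∈S))

  module _ {S f σ S' f'} (core : Step3Core A S f σ S' f') where

    min-rank-≤ : ∀ {q j} → q ∈ S' → InG A S f σ q j → f' q ≤ j
    min-rank-≤ q∈S' = proj₂ (proj₁ (proj₁ (proj₂ core)) _ q∈S') _

    ranking-antitone : ∀ {p q} → p ∈ S → q ∈ S' → q ∈ δ p σ → f' q ≤ f p
    ranking-antitone p∈S q∈S' q∈δ = min-rank-≤ q∈S' (_ , p∈S , inj₁ (refl , q∈δ))

    ranking-γ : ∀ {p q} → p ∈ S → q ∈ S' → q ∈ γ p σ → f' q ≤ 2 * (f p / 2)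
    ranking-γ p∈S q∈S' q∈γ = min-rank-≤ q∈S' (_ , p∈S , inj₂ (q∈γ , refl))

    rank-antitone : rankOf A S' f' ≤ rankOf A S f
    rank-antitone = rankOf-lub λ {q} q∈S' → from-predecessor q∈S' (Equivalence.to (proj₁ core q) q∈S')
      where
      from-predecessor : ∀ {q} → q ∈ S' → ∃ (λ p → p ∈ S × q ∈ δ p σ) → f' q ≤ rankOf A S f
      from-predecessor q∈S' (p , p∈S , q∈δ) = ≤-trans (ranking-antitone p∈S q∈S' q∈δ) (≤-rankOf p∈S)

  subsetOf : State A → Subset n
  subsetOf (q1 S) = S
  subsetOf (q2 S _ _ _) = S

  obligationsOf : State A → Subset n
  obligationsOf (q1 _) = ∅
  obligationsOf (q2 _ O _ _) = O

  rankingOf : State A → Fin n → ℕ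
  rankingOf (q1 _) _ = 0
  rankingOf (q2 _ _ f _) = f

  indexOf : State A → ℕ
  indexOf (q1 _) = 0
  indexOf (q2 _ _ _ i) = i

  Step₃ : State A → Fin k → State A → Set
  Step₃ s σ s' = Step3Case2 A s σ s' ⊎ Step3Case3 A s σ s'

  InheritsObligation : State A → Fin k → State A → Fin n → Set
  InheritsObligation s σ s' = InO'' A (obligationsOf s) σ (subsetOf s') (rankingOf s') (indexOf s)

  step₃-core : ∀ {s σ s'} → Step₃ s σ s' →
               Step3Core A (subsetOf s) (rankingOf s) σ (subsetOf s') (rankingOf s')
  step₃-core {q2 _ _ _ _} {s' = q2 _ _ _ _} (inj₁ case2) = proj₁ case2
  step₃-core {q2 _ _ _ _} {s' = q2 _ _ _ _} (inj₂ case3) = proj₁ case3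
  step₃-core {q1 _} (inj₁ ())
  step₃-core {q1 _} (inj₂ ())
  step₃-core {q2 _ _ _ _} {s' = q1 _} (inj₁ ())
  step₃-core {q2 _ _ _ _} {s' = q1 _} (inj₂ ())

  step-post : ∀ {s σ s'} → StepC A s σ s' → IsPost A (subsetOf s) σ (subsetOf s')
  step-post {q1 _} {s' = q1 _} (_ , inj₁ post) = post
  step-post {q1 _} {s' = q2 _ _ _ _} (_ , inj₁ (post , _)) = post
  step-post {q2 _ _ _ _} (_ , inj₁ ())
  step-post (_ , inj₂ step) = proj₁ (step₃-core step)

  q1-¬step₃ : ∀ {S σ s'} → ¬ Step₃ (q1 S) σ s'
  q1-¬step₃ (inj₁ ())
  q1-¬step₃ (inj₂ ())

  step₃-continues : ∀ {s σ s' σ' s''} → Step₃ s σ s' → StepC A s' σ' s'' → Step₃ s' σ' s''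
  step₃-continues {s' = q2 _ _ _ _} _ (_ , inj₁ ())
  step₃-continues {s' = q2 _ _ _ _} _ (_ , inj₂ step) = step
  step₃-continues {q1 _} (inj₁ ())
  step₃-continues {q1 _} (inj₂ ())
  step₃-continues {q2 _ _ _ _} {s' = q1 _} (inj₁ ())
  step₃-continues {q2 _ _ _ _} {s' = q1 _} (inj₂ ())

  step₃-valid : ∀ {s σ s' σ' s''} → StepC A s σ s' → Step₃ s' σ' s'' →
                Tight A (subsetOf s') (rankingOf s') × Even A (indexOf s')
  step₃-valid {s' = q2 _ _ _ _} ((tight , even , _) , _) _ = tight , even
  step₃-valid {s' = q1 _} _ (inj₁ ())
  step₃-valid {s' = q1 _} _ (inj₂ ())

  case2-index : ∀ {s σ s'} → Step3Case2 A s σ s' → indexOf s' ≡ indexOf s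
  case2-index {q2 _ _ _ _} {s' = q2 _ _ _ _} (_ , _ , _ , i'≡i) = i'≡i
  case2-index {q1 _} ()
  case2-index {q2 _ _ _ _} {s' = q1 _} ()

  case2-inherits : ∀ {s σ s' q} → Step3Case2 A s σ s' →
                   InheritsObligation s σ s' q → q ∈ obligationsOf s'
  case2-inherits {q2 _ _ _ _} {s' = q2 _ _ _ _} {q} (_ , _ , O' , _) = Equivalence.from (O' q)
  case2-inherits {q1 _} ()
  case2-inherits {q2 _ _ _ _} {s' = q1 _} ()

  case3-¬inherits : ∀ {s σ s' q} → Step3Case3 A s σ s' → ¬ InheritsObligation s σ s' q
  case3-¬inherits {q2 _ _ _ _} {s' = q2 _ _ _ _} (_ , O''≡∅ , _) = O''≡∅ _
  case3-¬inherits {q1 _} ()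
  case3-¬inherits {q2 _ _ _ _} {s' = q1 _} ()

  case3-index : ∀ {s σ s'} → Step3Case3 A s σ s' →
                indexOf s' ≡ (indexOf s + 2) % suc (rankOf A (subsetOf s') (rankingOf s'))
  case3-index {q2 _ _ _ _} {s' = q2 _ _ _ _} (_ , _ , i'≡ , _) = i'≡
  case3-index {q1 _} ()
  case3-index {q2 _ _ _ _} {s' = q1 _} ()

  case3-obligations : ∀ {s σ s' q} → Step3Case3 A s σ s' →
                      q ∈ subsetOf s' → rankingOf s' q ≡ indexOf s' → q ∈ obligationsOf s'
  case3-obligations {q2 _ _ _ _} {s' = q2 _ _ _ _} {q} (_ , _ , _ , O') q∈S' f'q≡i' =
    Equivalence.from (O' q) (q∈S' , f'q≡i')
  case3-obligations {q1 _} ()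
  case3-obligations {q2 _ _ _ _} {s' = q1 _} ()

module RankArgument {k n} (A : Automaton k n) (w : Word k)
  (ρ : ℕ → State A) (ρ-run : IsRunC A w ρ)
  (ρ-accepting : ∀ i → ∃ λ j → i ≤ j × AccC A (ρ j) (w j) (ρ (suc j)))
  (r : ℕ → Fin n) (r-run : IsRunA A w r) (r-γ : InfGamma A w r) where

  Step₃At Case₃At : ℕ → Set
  Step₃At j = Step₃ A (ρ j) (w j) (ρ (suc j))
  Case₃At j = Step3Case3 A (ρ j) (w j) (ρ (suc j))

  r∈S : ∀ j → r j ∈ subsetOf A (ρ j)
  r∈S zero = subst (λ s → r 0 ∈ subsetOf A s) (sym (proj₁ ρ-run)) (proj₁ r-run)
  r∈S (suc j) = Equivalence.from (step-post A (proj₂ ρ-run j) (r (suc j))) (r j , r∈S j , proj₂ r-run j)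

  accepting⇒case₃ : ∀ {j} → AccC A (ρ j) (w j) (ρ (suc j)) → Case₃At j
  accepting⇒case₃ (_ , inj₁ case3) = case3
  accepting⇒case₃ {j} (_ , inj₂ ρj≡∅) = ⊥-elim (∉⊥ (subst (λ s → r j ∈ subsetOf A s) ρj≡∅ (r∈S j)))

  case₃-infinitely-often : ∀ i → ∃ λ j → i ≤ j × Case₃At j
  case₃-infinitely-often i with ρ-accepting i
  ... | j , i≤j , acc = j , i≤j , accepting⇒case₃ acc

  j₀ : ℕ
  j₀ = proj₁ (case₃-infinitely-often 0)

  step₃ : ∀ {j} → j₀ ≤ j → Step₃At j
  step₃ = upward-induction {Step₃At} (λ {j} _ step → step₃-continues A step (proj₂ ρ-run (suc j)))
                           (inj₂ (proj₂ (proj₂ (case₃-infinitely-often 0))))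

  index : ℕ → ℕ
  index j = indexOf A (ρ j)

  valid : ∀ {j} → j₀ ≤ j → Tight A (subsetOf A (ρ j)) (rankingOf A (ρ j)) × Even A (index j)
  valid {zero} j₀≤0 = ⊥-elim (q1-¬step₃ A {Automaton.I A} {w 0} {ρ 1}
                                (subst (λ s → Step₃ A s (w 0) (ρ 1)) (proj₁ ρ-run) (step₃ j₀≤0)))
  valid {suc j} j₀≤j+1 = step₃-valid A (proj₂ ρ-run j) (step₃ j₀≤j+1)

  a R : ℕ → ℕ
  a j = rankingOf A (ρ j) (r j)
  R j = rankOf A (subsetOf A (ρ j)) (rankingOf A (ρ j))

  a-antitone : ∀ j → j₀ ≤ j → a (suc j) ≤ a j
  a-antitone j j₀≤j = ranking-antitone A (step₃-core A (step₃ j₀≤j)) (r∈S j) (r∈S (suc j)) (proj₂ r-run j)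

  R-antitone : ∀ j → j₀ ≤ j → R (suc j) ≤ R j
  R-antitone j j₀≤j = rank-antitone A (step₃-core A (step₃ j₀≤j))

  module Stable (t : ℕ) (j₀≤t : j₀ ≤ t)
    (a-stable : ∀ j → t ≤ j → a j ≡ a t) (R-stable : ∀ j → t ≤ j → R j ≡ R t) where

    j₀≤ : ∀ {j} → t ≤ j → j₀ ≤ j
    j₀≤ = ≤-trans j₀≤t

    v c M : ℕ
    v = a t
    c = v / 2
    M = proj₁ (tight⇒rank-odd A (proj₁ (valid j₀≤t)) (r∈S t))

    R≡2M+1 : ∀ {j} → t ≤ j → R j ≡ suc (2 * M)
    R≡2M+1 t≤j = trans (R-stable _ t≤j) (proj₂ (tight⇒rank-odd A (proj₁ (valid j₀≤t)) (r∈S t)))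

    v≡2c : v ≡ 2 * c
    v≡2c with r-γ t
    ... | j , t≤j , r∈γ = ≤-antisym
      (subst₂ (λ x y → x ≤ 2 * (y / 2)) (a-stable (suc j) (m≤n⇒m≤1+n t≤j)) (a-stable j t≤j)
        (ranking-γ A (step₃-core A (step₃ (j₀≤ t≤j))) (r∈S j) (r∈S (suc j)) r∈γ))
      (subst (_≤ v) (*-comm c 2) (m/n*n≤m v 2))

    c≤M : c ≤ M
    c≤M = half-≤ (subst₂ _≤_ v≡2c (R≡2M+1 ≤-refl) (≤-rankOf A (r∈S t)))

    Locked : ℕ → Set
    Locked j = index j ≡ v × r j ∈ obligationsOf A (ρ j)

    locked⇒inherits : ∀ {j} → t ≤ j → Locked j → InheritsObligation A (ρ j) (w j) (ρ (suc j)) (r (suc j))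
    locked⇒inherits {j} t≤j (i≡v , r∈O) =
      (r j , r∈O , proj₂ r-run j) , r∈S (suc j) , trans (a-stable (suc j) (m≤n⇒m≤1+n t≤j)) (sym i≡v)

    locked-step : ∀ {j} → t ≤ j → Locked j → Locked (suc j)
    locked-step {j} t≤j locked with step₃ (j₀≤ t≤j)
    ... | inj₁ case2 = trans (case2-index A case2) (proj₁ locked) , case2-inherits A case2 (locked⇒inherits t≤j locked)
    ... | inj₂ case3 = ⊥-elim (case3-¬inherits A case3 (locked⇒inherits t≤j locked))

    ¬locked : ∀ {j} → t ≤ j → ¬ Locked j
    ¬locked {j} t≤j locked = no-case₃-after (case₃-infinitely-often j)
      where
      no-case₃-after : ¬ ∃ (λ j' → j ≤ j' × Case₃At j')
      no-case₃-after (j' , j≤j' , case3) =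
        case3-¬inherits A case3 (locked⇒inherits (≤-trans t≤j j≤j')
          (upward-induction {Locked} (λ j≤i → locked-step (≤-trans t≤j j≤i)) locked j≤j'))

    -- Case-(2) steps keep the index, so the next case-(3) step starts from it.
    next-case₃ : ∀ {j} → t ≤ j → ∃ λ j' → j ≤ j' × Case₃At j' × index j' ≡ index j
    next-case₃ {j} t≤j =
      let j' , j≤j' , case3 = case₃-infinitely-often j
          d , j+d≡j' = m≤n⇒∃[o]m+o≡n j≤j'
      in walk d t≤j (subst Case₃At (trans (sym j+d≡j') (+-comm j d)) case3)
      where
      walk : ∀ d {j} → t ≤ j → Case₃At (d + j) → ∃ λ j' → j ≤ j' × Case₃At j' × index j' ≡ index j
      walk zero t≤j case3 = _ , ≤-refl , case3 , refl
      walk (suc d) {j} t≤j case3 with step₃ (j₀≤ t≤j)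
      ... | inj₂ case3' = j , ≤-refl , case3' , refl
      ... | inj₁ case2 with walk d (m≤n⇒m≤1+n t≤j) (subst Case₃At (sym (+-suc d j)) case3)
      ... | j' , j<j' , case3' , i≡ = j' , ≤-trans (n≤1+n j) j<j' , case3' , trans i≡ (case2-index A case2)

    advance : ∀ {j e} → t ≤ j → Case₃At j → index j ≡ 2 * e → index (suc j) ≡ 2 * cyc M e
    advance {j} {e} t≤j case3 i≡2e = begin
      index (suc j)                   ≡⟨ case3-index A case3 ⟩
      (index j + 2) % suc (R (suc j)) ≡⟨ cong (λ i → (i + 2) % suc (R (suc j))) i≡2e ⟩
      (2 * e + 2) % suc (R (suc j))   ≡⟨ cong (λ m → (2 * e + 2) % suc m) (R≡2M+1 (m≤n⇒m≤1+n t≤j)) ⟩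
      (2 * e + 2) % suc (suc (2 * M)) ≡⟨ double-cyc M e ⟩
      2 * cyc M e                     ∎
      where open ≡-Reasoning

    cycle : ∀ d {j e} → t ≤ j → index j ≡ 2 * e → iterate (cyc M) e (suc d) ≡ c → ⊥
    cycle d {e = e} t≤j i≡2e reaches with next-case₃ t≤j
    ... | j' , j≤j' , case3 , i'≡i = continue d reaches
      where
      t≤j' : t ≤ j'
      t≤j' = ≤-trans t≤j j≤j'
      t≤j'+1 : t ≤ suc j'
      t≤j'+1 = m≤n⇒m≤1+n t≤j'
      next≡ : index (suc j') ≡ 2 * cyc M e
      next≡ = advance t≤j' case3 (trans i'≡i i≡2e)
      continue : ∀ d → iterate (cyc M) (cyc M e) d ≡ c → ⊥
      continue zero cyc-e≡c = ¬locked t≤j'+1 (i≡v , r∈O)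
        where
        i≡v : index (suc j') ≡ v
        i≡v = trans next≡ (trans (cong (2 *_) cyc-e≡c) (sym v≡2c))
        r∈O : r (suc j') ∈ obligationsOf A (ρ (suc j'))
        r∈O = case3-obligations A case3 (r∈S (suc j')) (trans (a-stable (suc j') t≤j'+1) (sym i≡v))
      continue (suc d) = cycle d t≤j'+1 next≡

    contradiction : ⊥
    contradiction =
      let e , i≡2e = proj₂ (valid (m≤n⇒m≤1+n j₀≤t))
          d , reaches = cyc-reaches M e c≤M
      in cycle d (n≤1+n t) i≡2e reaches

  contradiction : ⊥
  contradiction =
    antitone⇒¬¬stable a a-antitone λ (t₁ , j₀≤t₁ , a-stable) →
    antitone⇒¬¬stable R (λ j t₁≤j → R-antitone j (≤-trans j₀≤t₁ t₁≤j)) λ (t , t₁≤t , R-stable) →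
    Stable.contradiction t (≤-trans j₀≤t₁ t₁≤t)
      (λ j t≤j → trans (a-stable j (≤-trans t₁≤t t≤j)) (sym (a-stable t t₁≤t))) R-stable

corollary1 : ∀ {k n} (A : Automaton k n) (w : Word k) → InLangC A w → InLangUCA A w
corollary1 A w (ρ , ρ-run , ρ-accepting) r r-run r-γ =
  RankArgument.contradiction A w ρ ρ-run ρ-accepting r r-run r-γ
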